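{- In the core model structure on $\mathcal{G}$, every graph is both fibrant and cofibrant; that is, for every graph $G$ the unique morphism from the empty graph to $G$ is a cofibration and the unique morphism from $G$ to the terminal graph is a fibration.
   Context: A graph is a finite set of vertices with a symmetric binary relation (loops allowed, no multiple edges); homomorphisms are vertex maps sending edges to edges. $\mathcal{G}$ is the category with one representative of each isomorphism class of finite graphs and homomorphisms as morphisms; its initial object is the empty graph, its terminal object the one-vertex graph with a loop, and coproduct is disjoint union. A retraction is a morphism $r:A\to B$ with some $s:B\to A$ such that $r\circ s=1_B$. The core $G_{core}$ of $G$ is a retract of $G$ with fewest vertices (unique up to isomorphism). A homomorphism $f:G\to H$ induces an isomorphism on cores if $r_H\circ f\circ s_G:G_{core}\to H_{core}$ is an isomorphism, where $s_G$ is a section $G_{core}\to G$ and $r_H$ a retraction $H\to H_{core}$. A morphism $f$ lifts on the left of $g$ ($g$ lifts on the right of $f$) if every commutative square with $f$ on the left and $g$ on the right has a diagonal filler. The core model structure on $\mathcal{G}$ is the model structure whose weak equivalences are the homomorphisms inducing isomorphisms on cores, whose cofibrations are the canonical injections into a coproduct (morphisms isomorphic, under the codomain, to an inclusion $A\to A+B$), and whose fibrations are the morphisms lifting on the right of all cofibrations that are weak equivalences. An object $X$ is cofibrant if the morphism from the initial object to $X$ is a cofibration, and fibrant if the morphism from $X$ to the terminal object is a fibration. -}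

module Defs where

open import Data.Nat using (ℕ; zero; suc; _+_; _≤_)
open import Data.Fin using (Fin; zero; splitAt; _↑ˡ_; _↑ʳ_)
open import Data.Bool using (Bool; true; false)
open import Data.Sum using (_⊎_; inj₁; inj₂)
open import Data.Product using (Σ; ∃; _×_; _,_)
open import Relation.Binary.PropositionalEquality using (_≡_; refl)

record Graph : Set where
  field
    n   : ℕ
    adj : Fin n → Fin n → Bool
    sym : ∀ i j → adj i j ≡ adj j i
open Graph public

Edge : (G : Graph) → Fin (n G) → Fin (n G) → Set
Edge G i j = adj G i j ≡ true

record Hom (G H : Graph) : Set where
  field
    map      : Fin (n G) → Fin (n H)
    preserve : ∀ i j → Edge G i j → Edge H (map i) (map j)
open Hom public

idHom : (G : Graph) → Hom G G
idHom G = record { map = λ i → i ; preserve = λ i j e → e }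

_∘H_ : {G H K : Graph} → Hom H K → Hom G H → Hom G K
g ∘H f = record { map = λ i → map g (map f i)
                ; preserve = λ i j e → preserve g _ _ (preserve f i j e) }

_≈H_ : {G H : Graph} → Hom G H → Hom G H → Set
_≈H_ {G} f g = ∀ (i : Fin (n G)) → map f i ≡ map g i

IsIso : {G H : Graph} → Hom G H → Set
IsIso {G} {H} f = Σ (Hom H G) λ g → ((g ∘H f) ≈H idHom G) × ((f ∘H g) ≈H idHom H)

emptyGraph : Graph
emptyGraph = record { n = 0 ; adj = λ () ; sym = λ () }

terminalGraph : Graph
terminalGraph = record { n = 1 ; adj = λ _ _ → true ; sym = λ _ _ → refl }

fromEmpty : (G : Graph) → Hom emptyGraph G
fromEmpty G = record { map = λ () ; preserve = λ () }

toTerminal : (G : Graph) → Hom G terminalGraph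
toTerminal G = record { map = λ _ → zero ; preserve = λ _ _ _ → refl }

sumAdj : (A B : Graph) → Fin (n A) ⊎ Fin (n B) → Fin (n A) ⊎ Fin (n B) → Bool
sumAdj A B (inj₁ i) (inj₁ j) = adj A i j
sumAdj A B (inj₁ i) (inj₂ j) = false
sumAdj A B (inj₂ i) (inj₁ j) = false
sumAdj A B (inj₂ i) (inj₂ j) = adj B i j

sumAdj-sym : (A B : Graph) → ∀ x y → sumAdj A B x y ≡ sumAdj A B y x
sumAdj-sym A B (inj₁ i) (inj₁ j) = sym A i j
sumAdj-sym A B (inj₁ i) (inj₂ j) = refl
sumAdj-sym A B (inj₂ i) (inj₁ j) = refl
sumAdj-sym A B (inj₂ i) (inj₂ j) = sym B i j

_⊕_ : Graph → Graph → Graph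
A ⊕ B = record
  { n = n A + n B
  ; adj = λ i j → sumAdj A B (splitAt (n A) i) (splitAt (n A) j)
  ; sym = λ i j → sumAdj-sym A B (splitAt (n A) i) (splitAt (n A) j) }

inl : (A B : Graph) → Hom A (A ⊕ B)
inl A B = record { map = λ i → i ↑ˡ n B ; preserve = λ i j e → pres i j e }
  where
  open import Data.Fin.Properties using (splitAt-↑ˡ)
  open import Relation.Binary.PropositionalEquality using (subst; sym)
  pres : ∀ i j → Edge A i j → sumAdj A B (splitAt (n A) (i ↑ˡ n B)) (splitAt (n A) (j ↑ˡ n B)) ≡ true
  pres i j e rewrite splitAt-↑ˡ (n A) i (n B) | splitAt-↑ˡ (n A) j (n B) = e

IsCofibration : {A X : Graph} → Hom A X → Set
IsCofibration {A} {X} f =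
  Σ Graph λ B → Σ (Hom (A ⊕ B) X) λ φ → IsIso φ × ((φ ∘H inl A B) ≈H f)

IsRetractData : (G C : Graph) → Hom C G → Hom G C → Set
IsRetractData G C s r = (r ∘H s) ≈H idHom C

record IsCore (G C : Graph) (s : Hom C G) (r : Hom G C) : Set where
  field
    retract : IsRetractData G C s r
    minimal : ∀ (C' : Graph) (s' : Hom C' G) (r' : Hom G C') →
              IsRetractData G C' s' r' → n C ≤ n C'

IsWeakEquivalence : {G H : Graph} → Hom G H → Set
IsWeakEquivalence {G} {H} f =
  Σ Graph λ CG → Σ (Hom CG G) λ sG → Σ (Hom G CG) λ rG →
  Σ Graph λ CH → Σ (Hom CH H) λ sH → Σ (Hom H CH) λ rH →
  IsCore G CG sG rG × IsCore H CH sH rH × IsIso (rH ∘H (f ∘H sG))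

LiftsLeftOf : {A X Y Z : Graph} → Hom A X → Hom Y Z → Set
LiftsLeftOf {A} {X} {Y} {Z} f g =
  ∀ (u : Hom A Y) (v : Hom X Z) → (g ∘H u) ≈H (v ∘H f) →
  Σ (Hom X Y) λ d → ((d ∘H f) ≈H u) × ((g ∘H d) ≈H v)

IsFibration : {Y Z : Graph} → Hom Y Z → Set
IsFibration g = ∀ {A X : Graph} (f : Hom A X) →
  IsCofibration f → IsWeakEquivalence f → LiftsLeftOf f g

IsCofibrant : Graph → Set
IsCofibrant G = IsCofibration (fromEmpty G)

IsFibrant : Graph → Set
IsFibrant G = IsFibration (toTerminal G)

module Submission where

-- Cofibrancy: the map ∅ → G is, up to the evident isomorphism
-- ∅ + G ≅ G, the canonical injection ∅ → ∅ + G.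
--
-- Fibrancy: since the target is terminal, lifting against G → 1 only asks
-- that every u : A → G extends along each trivial cofibration f : A → X.
-- Two general facts give this:
--   * a weak equivalence f : A → X admits a homomorphism back X → A,
--     namely  s_A ∘ (r_X ∘ f ∘ s_A)⁻¹ ∘ r_X  built from the cores;
--   * a cofibration A → X ≅ A + B along which there is a homomorphism
--     X → A lets any u : A → Y extend: send A by u and B through X → A
--     and then u.

open import Defs
open import Data.Product using (Σ; _×_; _,_)
open import Data.Fin using (zero; splitAt; _↑ˡ_; _↑ʳ_)
open import Data.Fin.Properties using (splitAt-↑ˡ; splitAt-↑ʳ)
open import Data.Sum using (inj₁; inj₂; [_,_])
open import Data.Bool using (true)
open import Relation.Binary.PropositionalEquality
  using (_≡_; refl; cong; module ≡-Reasoning)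
  renaming (sym to ≡-sym)

inr : (A B : Graph) → Hom B (A ⊕ B)
inr A B = record { map = n A ↑ʳ_ ; preserve = preserves }
  where
  preserves : ∀ i j → Edge B i j → Edge (A ⊕ B) (n A ↑ʳ i) (n A ↑ʳ j)
  preserves i j e rewrite splitAt-↑ʳ (n A) (n B) i | splitAt-↑ʳ (n A) (n B) j = e

copair : {A B Y : Graph} → Hom A Y → Hom B Y → Hom (A ⊕ B) Y
copair {A} {B} {Y} u h = record
  { map      = λ k → [ map u , map h ] (splitAt (n A) k)
  ; preserve = λ i j → preserves (splitAt (n A) i) (splitAt (n A) j) }
  where
  preserves : ∀ x y → sumAdj A B x y ≡ true →
              Edge Y ([ map u , map h ] x) ([ map u , map h ] y)
  preserves (inj₁ a) (inj₁ a′) e = preserve u a a′ e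
  preserves (inj₂ b) (inj₂ b′) e = preserve h b b′ e

copair-inl : {A B Y : Graph} (u : Hom A Y) (h : Hom B Y) →
             (copair u h ∘H inl A B) ≈H u
copair-inl {A} {B} u h a = cong [ map u , map h ] (splitAt-↑ˡ (n A) a (n B))

weakEquivalence-reverse : {A X : Graph} (f : Hom A X) →
                          IsWeakEquivalence f → Hom X A
weakEquivalence-reverse f (_ , sA , _ , _ , _ , rX , _ , _ , (inverse , _)) =
  sA ∘H (inverse ∘H rX)

extendAlongCofibration : {A X Y : Graph} (f : Hom A X) → IsCofibration f →
                         Hom X A → (u : Hom A Y) →
                         Σ (Hom X Y) λ d → (d ∘H f) ≈H u
extendAlongCofibration {A} {Y = Y} f (B , φ , (ψ , ψφ≈id , _) , φinl≈f) back u =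
  extension ∘H ψ , restricts
  where
  open ≡-Reasoning
  throughA : Hom B A
  throughA = back ∘H (φ ∘H inr A B)
  extension : Hom (A ⊕ B) Y
  extension = copair u (u ∘H throughA)
  restricts : ((extension ∘H ψ) ∘H f) ≈H u
  restricts a = begin
    map extension (map ψ (map f a))
      ≡⟨ cong (λ x → map extension (map ψ x)) (≡-sym (φinl≈f a)) ⟩
    map extension (map ψ (map φ (a ↑ˡ n B)))
      ≡⟨ cong (map extension) (ψφ≈id (a ↑ˡ n B)) ⟩
    map extension (a ↑ˡ n B)
      ≡⟨ copair-inl u (u ∘H throughA) a ⟩
    map u a ∎

toTerminal-unique : {X : Graph} (v w : Hom X terminalGraph) → v ≈H w
toTerminal-unique v w i with map v i | map w i
... | zero | zero = refl

emptyGraph-unit : (G : Graph) → Σ (Hom (emptyGraph ⊕ G) G) IsIso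
emptyGraph-unit G = fromSum , toSum , (λ _ → refl) , (λ _ → refl)
  where
  fromSum : Hom (emptyGraph ⊕ G) G
  fromSum = record { map = λ i → i ; preserve = λ _ _ e → e }
  toSum : Hom G (emptyGraph ⊕ G)
  toSum = record { map = λ i → i ; preserve = λ _ _ e → e }

cofibrant : (G : Graph) → IsCofibrant G
cofibrant G with emptyGraph-unit G
... | φ , isIso = G , φ , isIso , λ ()

-- Lifting against X → 1 reduces to extending along the trivial cofibration;
-- the lower triangle commutes because the target is terminal.
fibrant : (G : Graph) → IsFibrant G
fibrant G f cofibration weakEquivalence u v _
  with extendAlongCofibration f cofibration
         (weakEquivalence-reverse f weakEquivalence) u
... | d , restricts = d , restricts , toTerminal-unique (toTerminal G ∘H d) v

mainTheorem2 : ∀ (G : Graph) → IsCofibrant G × IsFibrant G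
mainTheorem2 G = cofibrant G , fibrant G
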